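{- For every positive integer $n$, $c^B_{2,0}(n)=0$ and $c^B_{2,1}(n)=2^n$; that is, $r^B_\alpha$ is odd for every pseudo-composition $\alpha$ of $n$.
   Context: A signed permutation of $[n]$ is a bijection $w$ of $\{\pm1,\ldots,\pm n\}$ with $w(-i)=-w(i)$; they form $\mathfrak{S}^B_n$. With $w(0):=0$, $D(w)=\{i\in\{0,\ldots,n-1\}: w(i)>w(i+1)\}$. A pseudo-composition of $n$ ($\alpha\models_0 n$) is a sequence $(\alpha_1,\ldots,\alpha_\ell)$ of integers with $\alpha_1\ge0$, $\alpha_2,\ldots,\alpha_\ell>0$, sum $n$, and $D(\alpha)=\{\alpha_1,\ldots,\alpha_1+\cdots+\alpha_{\ell-1}\}$; there are $2^n$ of them. $r^B_\alpha=|\{w\in\mathfrak{S}^B_n: D(w)=D(\alpha)\}|$ and $c^B_{p,i}(n)=|\{\alpha\models_0 n: r^B_\alpha\equiv i\pmod p\}|$. -}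

module Defs where

open import Data.Bool using (Bool; true; false; _∧_; not; if_then_else_)
open import Data.Nat using (ℕ; zero; suc; _+_; _∸_; _≡ᵇ_; _<ᵇ_; _%_)
open import Data.Integer as ℤ using (ℤ; +_; -_; ∣_∣)
open import Data.List using (List; []; _∷_; _++_; map; length; upTo; concatMap)
open import Relation.Nullary.Decidable using (does)
open import Data.Vec as Vec using (Vec; []; _∷_; toList)

boolFilter : {A : Set} → (A → Bool) → List A → List A
boolFilter p []       = []
boolFilter p (x ∷ xs) = if p x then x ∷ boolFilter p xs else boolFilter p xs

any : {A : Set} → (A → Bool) → List A → Bool
any p []       = false
any p (x ∷ xs) = if p x then true else any p xs

all : {A : Set} → (A → Bool) → List A → Bool
all p []       = true
all p (x ∷ xs) = p x ∧ all p xs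

sum : List ℕ → ℕ
sum []       = 0
sum (x ∷ xs) = x + sum xs

allVecs : {A : Set} → (k : ℕ) → List A → List (Vec A k)
allVecs zero    xs = [] ∷ []
allVecs (suc k) xs = concatMap (λ x → map (x ∷_) (allVecs k xs)) xs

allListsUpTo : {A : Set} → ℕ → List A → List (List A)
allListsUpTo zero    xs = [] ∷ []
allListsUpTo (suc k) xs = [] ∷ concatMap (λ x → map (x ∷_) (allListsUpTo k xs)) xs

elemℕ : ℕ → List ℕ → Bool
elemℕ x ys = any (λ y → x ≡ᵇ y) ys

distinctℕ : List ℕ → Bool
distinctℕ []       = true
distinctℕ (x ∷ xs) = not (elemℕ x xs) ∧ distinctℕ xs

eqListℕ : List ℕ → List ℕ → Bool
eqListℕ []       []       = true
eqListℕ (x ∷ xs) (y ∷ ys) = (x ≡ᵇ y) ∧ eqListℕ xs ys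
eqListℕ _        _        = false

-- Signed permutations of [n]
-- A signed permutation w is determined by its window (w(1),…,w(n)) ∈ ℤⁿ,
-- since w(-i) = -w(i).  Such a window defines a bijection of {±1,…,±n}
-- with w(-i) = -w(i) iff every entry is nonzero, has absolute value ≤ n,
-- and the absolute values are pairwise distinct.

isSignedPerm : (n : ℕ) → Vec ℤ n → Bool
isSignedPerm n w =
  all (λ z → (0 <ᵇ ∣ z ∣) ∧ (∣ z ∣ <ᵇ suc n)) (toList w)
  ∧ distinctℕ (map ∣_∣ (toList w))

signedValues : ℕ → List ℤ
signedValues n = map (λ k → + (suc k)) (upTo n) ++ map (λ k → - (+ (suc k))) (upTo n)

signedPerms : (n : ℕ) → List (Vec ℤ n)
signedPerms n = boolFilter (isSignedPerm n) (allVecs n (signedValues n))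

-- Descent set D(w) = { i ∈ {0,…,n-1} : w(i) > w(i+1) } with w(0) := 0,
-- listed in increasing order.
descentsFrom : ℕ → ℤ → List ℤ → List ℕ
descentsFrom i prev []       = []
descentsFrom i prev (z ∷ zs) =
  (if does (z ℤ.<? prev) then i ∷ [] else []) ++ descentsFrom (suc i) z zs

descentSet : {n : ℕ} → Vec ℤ n → List ℕ
descentSet w = descentsFrom 0 (+ 0) (toList w)

isPseudoComposition : ℕ → List ℕ → Bool
isPseudoComposition n []       = false
isPseudoComposition n (a ∷ as) = all (λ b → 0 <ᵇ b) as ∧ (sum (a ∷ as) ≡ᵇ n)

-- D(α) = {α₁, α₁+α₂, …, α₁+⋯+α_{ℓ-1}} (in increasing order)
partialSumsFrom : ℕ → List ℕ → List ℕ
partialSumsFrom s []       = []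
partialSumsFrom s (a ∷ []) = []
partialSumsFrom s (a ∷ b ∷ bs) = (s + a) ∷ partialSumsFrom (s + a) (b ∷ bs)

descentSetPC : List ℕ → List ℕ
descentSetPC α = partialSumsFrom 0 α

-- All pseudo-compositions of n (every one has length ≤ n+1 and parts ≤ n)
pseudoCompositions : ℕ → List (List ℕ)
pseudoCompositions n =
  boolFilter (isPseudoComposition n) (allListsUpTo (suc n) (upTo (suc n)))

rB : (n : ℕ) → List ℕ → ℕ
rB n α = length (boolFilter (λ w → eqListℕ (descentSet w) (descentSetPC α)) (signedPerms n))

cB : (p i n : ℕ) → ℕ
cB zero    i n = length (boolFilter (λ α → rB n α ≡ᵇ i) (pseudoCompositions n))
cB (suc p) i n = length (boolFilter (λ α → rB n α % suc p ≡ᵇ i % suc p) (pseudoCompositions n))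

-- Build the window w(1) … w(n) letter by letter, keeping track of the absolute values still
-- unused and of the previous letter p. Modulo 2 only the words whose next letter is ±c survive,
-- c the least unused value: after any other letter, c is still unused and smaller than that
-- letter, and such counts are even by induction. If |p| < c then +c is an ascent and −c a
-- descent, which gives the recursion of descentParity, equal to 1 on every strictly increasing
-- descent set; if |p| > c the letters ±c lie on the same side of p and their contributions
-- cancel. So every r^B_α is odd, and it remains to count the 2^n pseudo-compositions.

module Submission where

open import Defs
open import Data.Bool using (Bool; true; false; _∧_; not; if_then_else_; T)
open import Data.Bool.Properties using (∧-assoc; ∧-zeroʳ; T-∧; T-≡; ∧-commutativeMonoid)
open import Data.Empty using (⊥-elim)
open import Data.Unit using (⊤; tt)
open import Data.Product using (_×_; _,_; proj₁; proj₂; ∃)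
open import Data.Sum using (inj₁; inj₂)
open import Data.Integer as ℤ using (ℤ; -[1+_]; ∣_∣; +<+; -<+; -<-)
open import Data.List using (List; []; _∷_; _++_; map; length; upTo; applyUpTo; concatMap)
open import Data.List.Properties using (map-upTo; length-upTo; concatMap-++)
open import Data.Nat
  using (ℕ; zero; suc; _+_; _^_; _%_; _≡ᵇ_; _<ᵇ_; _≤_; _<_; z≤n; s≤s; z<s; s<s; parity)
open import Data.Nat.Properties
  using ( +-identityʳ; +-assoc; +-suc; ≤-refl; ≤-reflexive; ≤-trans; <⇒≤; <⇒≢; <⇒≱; <-irrefl
        ; <-asym; ≤-<-trans; <-≤-trans; m≤n⇒m≤1+n; m<n⇒m<1+n; n<1+n; m≤n⇒m<n∨m≡n; m<m+n
        ; m≤m+n; suc-injective; 0≢1+n; ≮⇒≥; ≤∧≢⇒<; _≟_; ≡ᵇ⇒≡; <ᵇ⇒<; <⇒<ᵇ )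
open import Data.Parity.Base as ℙ using (Parity; 0ℙ; 1ℙ)
import Data.Parity.Properties as ℙₚ
open import Data.Vec using (Vec; _∷_; toList)
open import Function using (_∘_; id)
open import Function.Bundles using (Equivalence)
open import Relation.Binary.PropositionalEquality
  using (_≡_; _≢_; refl; sym; trans; subst; cong; cong₂; module ≡-Reasoning)
open import Relation.Nullary using (contradiction; yes; no; does)
open import Relation.Nullary.Decidable using (dec-true; dec-false)

open import Algebra.Solver.CommutativeMonoid ∧-commutativeMonoid
  using (_⊕_; _⊜_) renaming (solve to ∧-solve)

count : {A : Set} → (A → Bool) → List A → ℕ
count p xs = length (boolFilter p xs)

module _ {A : Set} where

  count-cong : {p q : A → Bool} → (∀ x → p x ≡ q x) → (xs : List A) → count p xs ≡ count q xs
  count-cong eq [] = refl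
  count-cong {q = q} eq (x ∷ xs) rewrite eq x with q x
  ... | true  = cong suc (count-cong eq xs)
  ... | false = count-cong eq xs

  count-++ : (p : A → Bool) (xs ys : List A) → count p (xs ++ ys) ≡ count p xs + count p ys
  count-++ p [] ys = refl
  count-++ p (x ∷ xs) ys with p x
  ... | true  = cong suc (count-++ p xs ys)
  ... | false = count-++ p xs ys

  count-map : {B : Set} (p : B → Bool) (g : A → B) (xs : List A) →
    count p (map g xs) ≡ count (p ∘ g) xs
  count-map p g [] = refl
  count-map p g (x ∷ xs) with p (g x)
  ... | true  = cong suc (count-map p g xs)
  ... | false = count-map p g xs

  count-false : (xs : List A) → count (λ _ → false) xs ≡ 0
  count-false []       = refl
  count-false (x ∷ xs) = count-false xs

  count-true : (xs : List A) → count (λ _ → true) xs ≡ length xs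
  count-true []       = refl
  count-true (x ∷ xs) = cong suc (count-true xs)

  count-∧-false : (p : A → Bool) (xs : List A) → count (λ x → p x ∧ false) xs ≡ 0
  count-∧-false p xs = trans (count-cong (∧-zeroʳ ∘ p) xs) (count-false xs)

  count-∧ˡ : (b : Bool) (p : A → Bool) (xs : List A) →
    count (λ x → b ∧ p x) xs ≡ (if b then count p xs else 0)
  count-∧ˡ true  p xs = refl
  count-∧ˡ false p xs = count-false xs

  count-filter : (p q : A → Bool) (xs : List A) →
    length (boolFilter p (boolFilter q xs)) ≡ count (λ x → q x ∧ p x) xs
  count-filter p q [] = refl
  count-filter p q (x ∷ xs) with q x
  ... | false = count-filter p q xs
  ... | true with p x
  ...   | true  = cong suc (count-filter p q xs)
  ...   | false = count-filter p q xs

  count-filter-constant : {p q : A → Bool} (b : Bool) → (∀ x → q x ≡ true → p x ≡ b) →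
    (xs : List A) → length (boolFilter p (boolFilter q xs)) ≡ (if b then count q xs else 0)
  count-filter-constant true  _ [] = refl
  count-filter-constant false _ [] = refl
  count-filter-constant {q = q} b h (x ∷ xs) with q x in qx
  ... | false = count-filter-constant b h xs
  ... | true rewrite h x qx with b
  ...   | true  = cong suc (count-filter-constant true h xs)
  ...   | false = count-filter-constant false h xs

sumBelow : ℕ → (ℕ → ℕ) → ℕ
sumBelow zero    f = 0
sumBelow (suc n) f = f 0 + sumBelow n (f ∘ suc)

syntax sumBelow n (λ j → e) = ∑[ j < n ] e

∑-cong : ∀ n {f g : ℕ → ℕ} → (∀ j → f j ≡ g j) → sumBelow n f ≡ sumBelow n g
∑-cong zero    eq = refl
∑-cong (suc n) eq = cong₂ _+_ (eq 0) (∑-cong n (eq ∘ suc))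

∑-zero : ∀ n → ∑[ j < n ] 0 ≡ 0
∑-zero zero    = refl
∑-zero (suc n) = ∑-zero n

∑-snoc : ∀ n (f : ℕ → ℕ) → sumBelow (suc n) f ≡ sumBelow n f + f n
∑-snoc zero    f = +-identityʳ (f 0)
∑-snoc (suc n) f = trans (cong (f 0 +_) (∑-snoc n (f ∘ suc))) (sym (+-assoc (f 0) _ _))

count-concatMap-applyUpTo : {A B : Set} (p : A → Bool) (h : B → List A) (f : ℕ → B) (n : ℕ) →
  count p (concatMap h (applyUpTo f n)) ≡ ∑[ j < n ] count p (h (f j))
count-concatMap-applyUpTo p h f zero    = refl
count-concatMap-applyUpTo p h f (suc n) = trans (count-++ p (h (f 0)) _)
  (cong (count p (h (f 0)) +_) (count-concatMap-applyUpTo p h (f ∘ suc) n))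

count-applyUpTo-suc : (q : ℕ → Bool) (n : ℕ) → count q (applyUpTo suc n) ≡ count (q ∘ suc) (upTo n)
count-applyUpTo-suc q n = trans (cong (count q) (sym (map-upTo suc n))) (count-map q suc (upTo n))

count-upTo-suc : (q : ℕ → Bool) (n : ℕ) →
  count q (upTo (suc n)) ≡ count q (0 ∷ []) + count (q ∘ suc) (upTo n)
count-upTo-suc q n = trans (count-++ q (0 ∷ []) (applyUpTo suc n))
  (cong (count q (0 ∷ []) +_) (count-applyUpTo-suc q n))

count-upTo-remove : ∀ n {q q′ : ℕ → Bool} c → c < n → q c ≡ true → q′ c ≡ false →
  (∀ j → j ≢ c → q′ j ≡ q j) → count q (upTo n) ≡ suc (count q′ (upTo n))
count-upTo-remove (suc n) {q} {q′} zero _ qc q′c same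
  rewrite count-upTo-suc q n | count-upTo-suc q′ n | qc | q′c =
  cong suc (count-cong (λ j → sym (same (suc j) (λ ()))) (upTo n))
count-upTo-remove (suc n) {q} {q′} (suc c) (s≤s c<n) qc q′c same
  rewrite count-upTo-suc q n | count-upTo-suc q′ n | same 0 (λ ()) =
  trans (cong (count q (0 ∷ []) +_) (count-upTo-remove n c c<n qc q′c same′))
        (+-suc (count q (0 ∷ [])) _)
  where
  same′ : ∀ j → j ≢ c → q′ (suc j) ≡ q (suc j)
  same′ j j≢c = same (suc j) (j≢c ∘ suc-injective)

Least : ℕ → (ℕ → Bool) → Set
Least n q = ∃ λ c → c < n × q c ≡ true × (∀ j → j < c → q j ≡ false)

least-index : ∀ n (q : ℕ → Bool) → count q (upTo n) ≢ 0 → Least n q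
least-index zero    q nz = ⊥-elim (nz refl)
least-index (suc n) q nz with q 0 in q0
... | true  = 0 , z<s , q0 , λ _ ()
... | false with least-index n (q ∘ suc) (nz ∘ trans (count-applyUpTo-suc q n))
...   | c , c<n , qc , least = suc c , s≤s c<n , qc , λ { zero _ → q0 ; (suc j) (s≤s j<c) → least j j<c }

≡ᵇ-refl : ∀ m → (m ≡ᵇ m) ≡ true
≡ᵇ-refl zero    = refl
≡ᵇ-refl (suc m) = ≡ᵇ-refl m

-- does (m ≟ n) computes to m ≡ᵇ n.
≡ᵇ-false : ∀ {m n} → m ≢ n → (m ≡ᵇ n) ≡ false
≡ᵇ-false {m} {n} m≢n = dec-false (m ≟ n) m≢n

parity-∑-even : ∀ n (f : ℕ → ℕ) → (∀ j → j < n → parity (f j) ≡ 0ℙ) →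
  parity (sumBelow n f) ≡ 0ℙ
parity-∑-even zero    f even = refl
parity-∑-even (suc n) f even = trans (ℙₚ.+-homo-+ (f 0) _)
  (cong₂ ℙ._+_ (even 0 z<s) (parity-∑-even n (f ∘ suc) (λ j → even (suc j) ∘ s<s)))

parity-∑-single : ∀ n (f : ℕ → ℕ) c → c < n → (∀ j → j < n → j ≢ c → parity (f j) ≡ 0ℙ) →
  parity (sumBelow n f) ≡ parity (f c)
parity-∑-single (suc n) f zero _ even = begin
  parity (f 0 + sumBelow n (f ∘ suc))
    ≡⟨ ℙₚ.+-homo-+ (f 0) _ ⟩
  parity (f 0) ℙ.+ parity (sumBelow n (f ∘ suc))
    ≡⟨ cong (parity (f 0) ℙ.+_) (parity-∑-even n (f ∘ suc) even′) ⟩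
  parity (f 0) ℙ.+ 0ℙ
    ≡⟨ ℙₚ.+-identityʳ (parity (f 0)) ⟩
  parity (f 0)
    ∎
  where
  open ≡-Reasoning
  even′ : ∀ j → j < n → parity (f (suc j)) ≡ 0ℙ
  even′ j j<n = even (suc j) (s<s j<n) (λ ())
parity-∑-single (suc n) f (suc c) (s≤s c<n) even = trans (ℙₚ.+-homo-+ (f 0) _)
  (cong₂ ℙ._+_ (even 0 z<s (λ ())) (parity-∑-single n (f ∘ suc) c c<n even′))
  where
  even′ : ∀ j → j < n → j ≢ c → parity (f (suc j)) ≡ 0ℙ
  even′ j j<n j≢c = even (suc j) (s<s j<n) (j≢c ∘ suc-injective)

parity≡1ℙ⇒%2≡1 : ∀ m → parity m ≡ 1ℙ → m % 2 ≡ 1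
parity≡1ℙ⇒%2≡1 (suc zero)    _   = refl
parity≡1ℙ⇒%2≡1 (suc (suc m)) odd = parity≡1ℙ⇒%2≡1 m odd

-- Pseudo-compositions

module PseudoCompositionCount (m : ℕ) where

  lists : ℕ → List (List ℕ)
  lists k = allListsUpTo k (upTo (suc m))

  isCompositionOf : ℕ → List ℕ → Bool
  isCompositionOf t as = all (λ b → 0 <ᵇ b) as ∧ (sum as ≡ᵇ t)

  compositionsAfter : ℕ → ℕ → ℕ → ℕ
  compositionsAfter k a t = count (λ as → all (λ b → 0 <ᵇ b) as ∧ (a + sum as ≡ᵇ t)) (lists k)

  compositions : ℕ → ℕ → ℕ
  compositions k = compositionsAfter k 0

  pseudoCompositionCount : ℕ → ℕ → ℕ
  pseudoCompositionCount k t = ∑[ a < suc m ] compositionsAfter k a t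

  compositionsAfter-0 : ∀ k a → compositionsAfter k (suc a) 0 ≡ 0
  compositionsAfter-0 k a = count-∧-false _ (lists k)

  compositionsAfter-> : ∀ k a t → t < a → compositionsAfter k a t ≡ 0
  compositionsAfter-> k (suc a) zero    _         = compositionsAfter-0 k a
  compositionsAfter-> k (suc a) (suc t) (s≤s t<a) = compositionsAfter-> k a t t<a

  ∑-compositionsAfter : ∀ k t → t < m → ∑[ a < m ] compositionsAfter k a t ≡ pseudoCompositionCount k t
  ∑-compositionsAfter k t t<m = begin
    below                            ≡⟨ +-identityʳ below ⟨
    below + 0                        ≡⟨ cong (below +_) (compositionsAfter-> k m t t<m) ⟨
    below + compositionsAfter k m t  ≡⟨ ∑-snoc m (λ a → compositionsAfter k a t) ⟨
    pseudoCompositionCount k t       ∎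
    where
    open ≡-Reasoning
    below : ℕ
    below = ∑[ a < m ] compositionsAfter k a t

  compositions-suc : ∀ k t →
    compositions (suc k) t ≡ count (isCompositionOf t) ([] ∷ []) + ∑[ b < m ] compositionsAfter k (suc b) t
  compositions-suc k t = begin
    compositions (suc k) t
      ≡⟨ count-++ p ([] ∷ []) (concatMap extend (upTo (suc m))) ⟩
    count p ([] ∷ []) + count p (concatMap extend (upTo (suc m)))
      ≡⟨ cong (count p ([] ∷ []) +_) (count-concatMap-applyUpTo p extend id (suc m)) ⟩
    count p ([] ∷ []) + ∑[ b < suc m ] count p (extend b)
      ≡⟨ cong (count p ([] ∷ []) +_) (∑-cong (suc m) (λ b → count-map p (b ∷_) (lists k))) ⟩
    count p ([] ∷ []) + (count (λ _ → false) (lists k) + positive)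
      ≡⟨ cong (λ z → count p ([] ∷ []) + (z + positive)) (count-false (lists k)) ⟩
    count p ([] ∷ []) + positive
      ∎
    where
    open ≡-Reasoning
    p : List ℕ → Bool
    p = isCompositionOf t
    extend : ℕ → List (List ℕ)
    extend b = map (b ∷_) (lists k)
    positive : ℕ
    positive = ∑[ b < m ] compositionsAfter k (suc b) t

  pseudoCompositionCount-0 : ∀ k → pseudoCompositionCount k 0 ≡ 1
  pseudoCompositionCount-0 k = cong₂ _+_ (compositions-0 k) (vanish k)
    where
    vanish : ∀ k → ∑[ a < m ] compositionsAfter k (suc a) 0 ≡ 0
    vanish k = trans (∑-cong m (compositionsAfter-0 k)) (∑-zero m)
    compositions-0 : ∀ k → compositions k 0 ≡ 1
    compositions-0 zero    = refl
    compositions-0 (suc k) = trans (compositions-suc k 0) (cong suc (vanish k))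

  -- A pseudo-composition of t + 1 starts with 0 followed by a composition whose first part b + 1
  -- can be lowered to b, or it starts with a + 1, which can be lowered to a.
  pseudoCompositionCount-suc : ∀ k t → t < m →
    pseudoCompositionCount (suc k) (suc t) ≡ pseudoCompositionCount k t + pseudoCompositionCount (suc k) t
  pseudoCompositionCount-suc k t t<m = cong₂ _+_
    (trans (compositions-suc k (suc t)) (∑-compositionsAfter k t t<m))
    (∑-compositionsAfter (suc k) t t<m)

  pseudoCompositionCount-value : ∀ k t → t ≤ k → t ≤ m → pseudoCompositionCount k t ≡ 2 ^ t
  pseudoCompositionCount-value k       zero    _         _   = pseudoCompositionCount-0 k
  pseudoCompositionCount-value (suc k) (suc t) (s≤s t≤k) t<m = begin
    pseudoCompositionCount (suc k) (suc t)
      ≡⟨ pseudoCompositionCount-suc k t t<m ⟩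
    pseudoCompositionCount k t + pseudoCompositionCount (suc k) t
      ≡⟨ cong₂ _+_ (value k t≤k) (value (suc k) (m≤n⇒m≤1+n t≤k)) ⟩
    2 ^ t + 2 ^ t
      ≡⟨ cong (2 ^ t +_) (+-identityʳ (2 ^ t)) ⟨
    2 ^ suc t
      ∎
    where
    open ≡-Reasoning
    value : ∀ k → t ≤ k → pseudoCompositionCount k t ≡ 2 ^ t
    value k t≤k = pseudoCompositionCount-value k t t≤k (<⇒≤ t<m)

length-pseudoCompositions : ∀ m → length (pseudoCompositions m) ≡ 2 ^ m
length-pseudoCompositions m =
  trans (count-concatMap-applyUpTo (isPseudoComposition m) (λ a → map (a ∷_) (lists m)) id (suc m))
    (trans (∑-cong (suc m) (λ a → count-map (isPseudoComposition m) (a ∷_) (lists m)))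
      (pseudoCompositionCount-value m m ≤-refl ≤-refl))
  where open PseudoCompositionCount m

-- Descent sets

-- Consumes position i of a prescribed descent set S according to whether it is a descent (d):
-- f continues with the rest of S, or the result is z if d holds but S does not start with i.
withResidual : {A : Set} → A → Bool → ℕ → (List ℕ → A) → List ℕ → A
withResidual z false i f S       = f S
withResidual z true  i f []      = z
withResidual z true  i f (j ∷ S) = if i ≡ᵇ j then f S else z

parity-withResidual : ∀ d i {f : List ℕ → ℕ} {e : List ℕ → Parity} → (∀ S → parity (f S) ≡ e S) →
  ∀ S → parity (withResidual 0 d i f S) ≡ withResidual 0ℙ d i e S
parity-withResidual false i eq S       = eq S
parity-withResidual true  i eq []      = refl
parity-withResidual true  i eq (j ∷ S) with i ≡ᵇ j
... | true  = eq S
... | false = refl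

withResidual-constant : ∀ {A : Set} (z : A) d i S → withResidual z d i (λ _ → z) S ≡ z
withResidual-constant z false i S       = refl
withResidual-constant z true  i []      = refl
withResidual-constant z true  i (j ∷ S) with i ≡ᵇ j
... | true  = refl
... | false = refl

-- The parity of the number of signed words of length k with descent set S (positions counted
-- from i) whose letters all exceed the previous letter in absolute value: modulo 2 only the
-- first letters −c (a descent) and +c (none) count, c the least available absolute value.
descentParity : ℕ → ℕ → List ℕ → Parity
descentParity i zero    []      = 1ℙ
descentParity i zero    (_ ∷ _) = 0ℙ
descentParity i (suc k) S =
  withResidual 0ℙ true i (descentParity (suc i) k) S ℙ.+ withResidual 0ℙ false i (descentParity (suc i) k) S

IncreasingBetween : ℕ → ℕ → List ℕ → Set
IncreasingBetween lo hi []      = ⊤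
IncreasingBetween lo hi (j ∷ S) = lo ≤ j × j < hi × IncreasingBetween (suc j) hi S

descentParity-below : ∀ k {i j} S → j < i → descentParity i k (j ∷ S) ≡ 0ℙ
descentParity-below zero    S j<i = refl
descentParity-below (suc k) {i} {j} S j<i rewrite ≡ᵇ-false {i} {j} (λ i≡j → <-irrefl (sym i≡j) j<i) =
  descentParity-below k S (m<n⇒m<1+n j<i)

descentParity-increasing : ∀ k {i hi} S → i + k ≡ hi → IncreasingBetween i hi S → descentParity i k S ≡ 1ℙ
descentParity-increasing zero        []      _    _                 = refl
descentParity-increasing zero    {i} (j ∷ S) refl (i≤j , j<i+0 , _) =
  ⊥-elim (<-irrefl (sym (+-identityʳ i)) (≤-<-trans i≤j j<i+0))
descentParity-increasing (suc k) {i} []      i+k≡hi _ =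
  descentParity-increasing k [] (trans (sym (+-suc i k)) i+k≡hi) tt
descentParity-increasing (suc k) {i} (j ∷ S) i+k≡hi (i≤j , j<hi , inc) with m≤n⇒m<n∨m≡n i≤j
... | inj₂ refl rewrite ≡ᵇ-refl i | descentParity-below k S (n<1+n i) =
  cong (ℙ._+ 0ℙ) (descentParity-increasing k S (trans (sym (+-suc i k)) i+k≡hi) inc)
... | inj₁ i<j rewrite ≡ᵇ-false {i} {j} (<⇒≢ i<j) =
  descentParity-increasing k (j ∷ S) (trans (sym (+-suc i k)) i+k≡hi) (i<j , j<hi , inc)

partialSums-increasing : ∀ s a bs {lo hi} → T (all (λ b → 0 <ᵇ b) bs) →
  lo ≤ s + a → s + a + sum bs ≤ hi →
  IncreasingBetween lo hi (partialSumsFrom s (a ∷ bs))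
partialSums-increasing s a []       _   _   _  = tt
partialSums-increasing s a (b ∷ bs) pos lo≤ le =
  lo≤ ,
  <-≤-trans (m<m+n (s + a) (<-≤-trans 0<b (m≤m+n b (sum bs)))) le ,
  partialSums-increasing (s + a) b bs pos′ (m<m+n (s + a) 0<b)
    (≤-trans (≤-reflexive (+-assoc (s + a) b (sum bs))) le)
  where
  0<b : 0 < b
  0<b = <ᵇ⇒< 0 b (proj₁ (Equivalence.to T-∧ pos))
  pos′ : T (all (λ b → 0 <ᵇ b) bs)
  pos′ = proj₂ (Equivalence.to T-∧ pos)

descentParity-pseudoComposition : ∀ n α → T (isPseudoComposition n α) →
  descentParity 0 n (descentSetPC α) ≡ 1ℙ
descentParity-pseudoComposition n (a ∷ as) isPC =
  descentParity-increasing n (descentSetPC (a ∷ as)) refl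
    (partialSums-increasing 0 a as (proj₁ split) z≤n (≤-reflexive (≡ᵇ⇒≡ (a + sum as) n (proj₂ split))))
  where
  split : T (all (λ b → 0 <ᵇ b) as) × T (a + sum as ≡ᵇ n)
  split = Equivalence.to T-∧ isPC

±-straddle : ∀ {c} p → ∣ p ∣ ≤ c →
  does (ℤ.+ suc c ℤ.<? p) ≡ false × does (-[1+ c ] ℤ.<? p) ≡ true
±-straddle {c} (ℤ.+ a)  a≤c =
  dec-false (ℤ.+ suc c ℤ.<? ℤ.+ a) (λ { (+<+ c<a) → <⇒≱ c<a (m≤n⇒m≤1+n a≤c) }) ,
  dec-true (-[1+ c ] ℤ.<? ℤ.+ a) -<+
±-straddle {c} -[1+ a ] a<c =
  dec-false (ℤ.+ suc c ℤ.<? -[1+ a ]) (λ ()) ,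
  dec-true (-[1+ c ] ℤ.<? -[1+ a ]) (-<- a<c)

±-same-side : ∀ {c} p → suc c < ∣ p ∣ → does (ℤ.+ suc c ℤ.<? p) ≡ does (-[1+ c ] ℤ.<? p)
±-same-side {c} (ℤ.+ a)  c<a = trans
  (dec-true (ℤ.+ suc c ℤ.<? ℤ.+ a) (+<+ c<a))
  (sym (dec-true (-[1+ c ] ℤ.<? ℤ.+ a) -<+))
±-same-side {c} -[1+ a ] (s<s c<a) = trans
  (dec-false (ℤ.+ suc c ℤ.<? -[1+ a ]) (λ ()))
  (sym (dec-false (-[1+ c ] ℤ.<? -[1+ a ]) (λ { (-<- a<c) → <-asym a<c c<a })))

-- Signed permutations modulo 2

module SignedWords (n : ℕ) where

  letters : List ℤ
  letters = signedValues n

  inRange : ℤ → Bool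
  inRange z = (0 <ᵇ ∣ z ∣) ∧ (∣ z ∣ <ᵇ suc n)

  avoids : List ℕ → ℤ → Bool
  avoids U z = not (elemℕ ∣ z ∣ U)

  fresh : List ℕ → ℤ → Bool
  fresh U z = inRange z ∧ avoids U z

  admissible : List ℕ → List ℤ → Bool
  admissible U []       = true
  admissible U (z ∷ zs) = fresh U z ∧ admissible (∣ z ∣ ∷ U) zs

  avoids-∷ : ∀ a U zs → all (avoids (a ∷ U)) zs ≡ not (elemℕ a (map ∣_∣ zs)) ∧ all (avoids U) zs
  avoids-∷ a U []       = refl
  avoids-∷ a U (z ∷ zs) with a ≟ ∣ z ∣
  ... | yes refl rewrite ≡ᵇ-refl a = refl
  ... | no a≢z rewrite ≡ᵇ-false a≢z | ≡ᵇ-false (a≢z ∘ sym) | avoids-∷ a U zs =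
    ∧-solve 3 (λ v e A → v ⊕ (e ⊕ A) ⊜ e ⊕ (v ⊕ A)) refl
      (avoids U z) (not (elemℕ a (map ∣_∣ zs))) (all (avoids U) zs)

  admissible-conjunction : ∀ U zs →
    admissible U zs ≡ all inRange zs ∧ (all (avoids U) zs ∧ distinctℕ (map ∣_∣ zs))
  admissible-conjunction U []       = refl
  admissible-conjunction U (z ∷ zs)
    rewrite admissible-conjunction (∣ z ∣ ∷ U) zs | avoids-∷ ∣ z ∣ U zs =
    ∧-solve 6 (λ r v R e A D → (r ⊕ v) ⊕ (R ⊕ ((e ⊕ A) ⊕ D)) ⊜ (r ⊕ R) ⊕ ((v ⊕ A) ⊕ (e ⊕ D))) refl
      (inRange z) (avoids U z) (all inRange zs) (not (elemℕ ∣ z ∣ (map ∣_∣ zs)))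
      (all (avoids U) zs) (distinctℕ (map ∣_∣ zs))

  all-avoids-[] : ∀ zs → all (avoids []) zs ≡ true
  all-avoids-[] []       = refl
  all-avoids-[] (z ∷ zs) = all-avoids-[] zs

  isSignedPerm-admissible : (w : Vec ℤ n) → isSignedPerm n w ≡ admissible [] (toList w)
  isSignedPerm-admissible w = sym (trans (admissible-conjunction [] zs)
    (cong (λ b → all inRange zs ∧ (b ∧ distinctℕ (map ∣_∣ zs))) (all-avoids-[] zs)))
    where
    zs : List ℤ
    zs = toList w

  matches : List ℕ → ℕ → ℤ → List ℕ → List ℤ → Bool
  matches U i p S zs = admissible U zs ∧ eqListℕ (descentsFrom i p zs) S

  #matching : List ℕ → ℕ → ℤ → List ℕ → ℕ → ℕ
  #matching U i p S k = count (λ w → matches U i p S (toList w)) (allVecs k letters)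

  rB-#matching : ∀ α → rB n α ≡ #matching [] 0 (ℤ.+ 0) (descentSetPC α) n
  rB-#matching α = trans (count-filter _ (isSignedPerm n) (allVecs n letters))
    (count-cong (λ w → cong (_∧ eqListℕ (descentSet w) (descentSetPC α)) (isSignedPerm-admissible w))
                (allVecs n letters))

  letterCount : List ℕ → ℕ → ℤ → List ℕ → ℕ → ℤ → ℕ
  letterCount U i p S k x = if fresh U x
    then withResidual 0 (does (x ℤ.<? p)) i (λ S′ → #matching (∣ x ∣ ∷ U) (suc i) x S′ k) S
    else 0

  #matching-∷ : ∀ U i p S k x →
    count (λ w → matches U i p S (x ∷ toList w)) (allVecs k letters) ≡ letterCount U i p S k x
  #matching-∷ U i p S k x =
    trans (count-cong (λ w → ∧-assoc (fresh U x) (admissible (∣ x ∣ ∷ U) (toList w)) _) (allVecs k letters))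
      (trans (count-∧ˡ (fresh U x) _ (allVecs k letters))
        (cong (if fresh U x then_else 0) (residual (does (x ℤ.<? p)) S)))
    where
    residual : ∀ d S →
      count (λ w → admissible (∣ x ∣ ∷ U) (toList w)
                   ∧ eqListℕ ((if d then i ∷ [] else []) ++ descentsFrom (suc i) x (toList w)) S)
            (allVecs k letters)
      ≡ withResidual 0 d i (λ S′ → #matching (∣ x ∣ ∷ U) (suc i) x S′ k) S
    residual false S       = refl
    residual true  []      = count-∧-false _ (allVecs k letters)
    residual true  (j ∷ S) with i ≡ᵇ j
    ... | true  = refl
    ... | false = count-∧-false _ (allVecs k letters)

  #matching-suc : ∀ U i p S k → #matching U i p S (suc k) ≡
    ∑[ j < n ] letterCount U i p S k (ℤ.+ suc j) + ∑[ j < n ] letterCount U i p S k -[1+ j ]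
  #matching-suc U i p S k = begin
    count P (concatMap extend (positives ++ negatives))
      ≡⟨ cong (count P) (concatMap-++ extend positives negatives) ⟩
    count P (concatMap extend positives ++ concatMap extend negatives)
      ≡⟨ count-++ P (concatMap extend positives) (concatMap extend negatives) ⟩
    count P (concatMap extend positives) + count P (concatMap extend negatives)
      ≡⟨ cong₂ _+_ (byLetter (λ j → ℤ.+ suc j)) (byLetter -[1+_]) ⟩
    ∑[ j < n ] letterCount U i p S k (ℤ.+ suc j) + ∑[ j < n ] letterCount U i p S k -[1+ j ]
      ∎
    where
    open ≡-Reasoning
    P : Vec ℤ (suc k) → Bool
    P w = matches U i p S (toList w)
    extend : ℤ → List (Vec ℤ (suc k))
    extend x = map (x ∷_) (allVecs k letters)
    positives negatives : List ℤ
    positives = map (λ j → ℤ.+ suc j) (upTo n)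
    negatives = map (λ j → ℤ.- (ℤ.+ suc j)) (upTo n)
    byLetter : (σ : ℕ → ℤ) →
      count P (concatMap extend (map σ (upTo n))) ≡ ∑[ j < n ] letterCount U i p S k (σ j)
    byLetter σ = begin
      count P (concatMap extend (map σ (upTo n)))
        ≡⟨ cong (count P ∘ concatMap extend) (map-upTo σ n) ⟩
      count P (concatMap extend (applyUpTo σ n))
        ≡⟨ count-concatMap-applyUpTo P extend σ n ⟩
      ∑[ j < n ] count P (extend (σ j))
        ≡⟨ ∑-cong n (λ j → trans (count-map P (σ j ∷_) (allVecs k letters))
                                 (#matching-∷ U i p S k (σ j))) ⟩
      ∑[ j < n ] letterCount U i p S k (σ j)
        ∎

  -- The index j stands for the absolute value j + 1.
  available : List ℕ → ℕ → Bool
  available U j = not (elemℕ (suc j) U)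

  #available : List ℕ → ℕ
  #available U = count (available U) (upTo n)

  fresh-available : ∀ U x {j} → ∣ x ∣ ≡ suc j → j < n → fresh U x ≡ available U j
  fresh-available U x {j} eq j<n rewrite eq | Equivalence.to T-≡ (<⇒<ᵇ j<n) = refl

  available-∷-self : ∀ U x {j} → ∣ x ∣ ≡ suc j → available (∣ x ∣ ∷ U) j ≡ false
  available-∷-self U x {j} eq rewrite eq | ≡ᵇ-refl j = refl

  available-∷-other : ∀ U x {j j′} → ∣ x ∣ ≡ suc j → j′ ≢ j →
    available (∣ x ∣ ∷ U) j′ ≡ available U j′
  available-∷-other U x eq j′≢j rewrite eq | ≡ᵇ-false j′≢j = refl

  #available-∷ : ∀ U x {j} → ∣ x ∣ ≡ suc j → j < n → available U j ≡ true →
    #available U ≡ suc (#available (∣ x ∣ ∷ U))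
  #available-∷ U x eq j<n avail =
    count-upTo-remove n _ j<n avail (available-∷-self U x eq) (λ j′ → available-∷-other U x eq)

  least-available : ∀ U {k} → #available U ≡ suc k → Least n (available U)
  least-available U #U = least-index n (available U) (λ #U≡0 → 0≢1+n (trans (sym #U≡0) #U))

  Below : ℤ → List ℕ → Set
  Below p U = ∀ j → j < n → available U j ≡ true → ∣ p ∣ ≤ j

  ParityBelow ParityAbove : ℕ → Set
  ParityBelow k = ∀ U i p S → #available U ≡ k → Below p U →
    parity (#matching U i p S k) ≡ descentParity i k S
  ParityAbove k = ∀ U i p S j → #available U ≡ k → j < n → available U j ≡ true → suc j < ∣ p ∣ →
    parity (#matching U i p S k) ≡ 0ℙ

  parity-letterCount : ∀ U i p S k x {e : List ℕ → Parity} → fresh U x ≡ true →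
    (∀ S′ → parity (#matching (∣ x ∣ ∷ U) (suc i) x S′ k) ≡ e S′) →
    parity (letterCount U i p S k x) ≡ withResidual 0ℙ (does (x ℤ.<? p)) i e S
  parity-letterCount U i p S k x isFresh eq rewrite isFresh = parity-withResidual (does (x ℤ.<? p)) i eq S

  module Step (k : ℕ) (below : ParityBelow k) (above : ParityAbove k)
              (U : List ℕ) (#U : #available U ≡ suc k)
              (c : ℕ) (c<n : c < n) (c-available : available U c ≡ true)
              (c-least : ∀ j → j < c → available U j ≡ false) where

    c≤ : ∀ j → available U j ≡ true → c ≤ j
    c≤ j avail = ≮⇒≥ (λ j<c → contradiction (trans (sym avail) (c-least j j<c)) λ ())

    #available-after : ∀ x {j} → ∣ x ∣ ≡ suc j → j < n → available U j ≡ true →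
      #available (∣ x ∣ ∷ U) ≡ k
    #available-after x eq j<n avail = suc-injective (trans (sym (#available-∷ U x eq j<n avail)) #U)

    other-letter : ∀ i p S x {j} → ∣ x ∣ ≡ suc j → j < n → j ≢ c →
      parity (letterCount U i p S k x) ≡ 0ℙ
    other-letter i p S x {j} eq j<n j≢c with available U j in avail
    ... | false rewrite trans (fresh-available U x eq j<n) avail = refl
    ... | true  = trans
      (parity-letterCount U i p S k x (trans (fresh-available U x eq j<n) avail)
        (λ S′ → above (∣ x ∣ ∷ U) (suc i) x S′ c (#available-after x eq j<n avail) c<n
                  (trans (available-∷-other U x eq (j≢c ∘ sym)) c-available)
                  (subst (suc c <_) (sym eq) (s<s (≤∧≢⇒< (c≤ j avail) (j≢c ∘ sym))))))
      (withResidual-constant 0ℙ (does (x ℤ.<? p)) i S)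

    least-letter : ∀ i p S x → ∣ x ∣ ≡ suc c →
      parity (letterCount U i p S k x) ≡ withResidual 0ℙ (does (x ℤ.<? p)) i (descentParity (suc i) k) S
    least-letter i p S x eq =
      parity-letterCount U i p S k x (trans (fresh-available U x eq c<n) c-available)
        (λ S′ → below (∣ x ∣ ∷ U) (suc i) x S′ (#available-after x eq c<n c-available) x-below)
      where
      x-below : Below x (∣ x ∣ ∷ U)
      x-below j j<n avail′ = subst (_≤ j) (sym eq) (≤∧≢⇒< (c≤ j avail) c≢j)
        where
        c≢j : c ≢ j
        c≢j refl = contradiction (trans (sym avail′) (available-∷-self U x eq)) λ ()
        avail : available U j ≡ true
        avail = trans (sym (available-∷-other U x eq (c≢j ∘ sym))) avail′

    step : ∀ i p S → parity (#matching U i p S (suc k)) ≡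
      withResidual 0ℙ (does (ℤ.+ suc c ℤ.<? p)) i (descentParity (suc i) k) S ℙ.+
      withResidual 0ℙ (does (-[1+ c ] ℤ.<? p)) i (descentParity (suc i) k) S
    step i p S = begin
      parity (#matching U i p S (suc k))
        ≡⟨ cong parity (#matching-suc U i p S k) ⟩
      parity (∑[ j < n ] letterCount U i p S k (ℤ.+ suc j) + ∑[ j < n ] letterCount U i p S k -[1+ j ])
        ≡⟨ ℙₚ.+-homo-+ (∑[ j < n ] letterCount U i p S k (ℤ.+ suc j)) _ ⟩
      parity (∑[ j < n ] letterCount U i p S k (ℤ.+ suc j)) ℙ.+
      parity (∑[ j < n ] letterCount U i p S k -[1+ j ])
        ≡⟨ cong₂ ℙ._+_
             (parity-∑-single n _ c c<n (λ j j<n j≢c → other-letter i p S (ℤ.+ suc j) refl j<n j≢c))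
             (parity-∑-single n _ c c<n (λ j j<n j≢c → other-letter i p S -[1+ j ] refl j<n j≢c)) ⟩
      parity (letterCount U i p S k (ℤ.+ suc c)) ℙ.+ parity (letterCount U i p S k -[1+ c ])
        ≡⟨ cong₂ ℙ._+_ (least-letter i p S (ℤ.+ suc c) refl) (least-letter i p S -[1+ c ] refl) ⟩
      withResidual 0ℙ (does (ℤ.+ suc c ℤ.<? p)) i (descentParity (suc i) k) S ℙ.+
      withResidual 0ℙ (does (-[1+ c ] ℤ.<? p)) i (descentParity (suc i) k) S
        ∎
      where open ≡-Reasoning

    step-below : ∀ i p S → ∣ p ∣ ≤ c → parity (#matching U i p S (suc k)) ≡ descentParity i (suc k) S
    step-below i p S |p|≤c with ±-straddle p |p|≤c
    ... | ascent , descent rewrite step i p S | ascent | descent =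
      ℙₚ.+-comm (descentParity (suc i) k S) _

    step-above : ∀ i p S → suc c < ∣ p ∣ → parity (#matching U i p S (suc k)) ≡ 0ℙ
    step-above i p S c<|p| rewrite step i p S | ±-same-side p c<|p| =
      ℙₚ.p+p≡0ℙ (withResidual 0ℙ (does (-[1+ c ] ℤ.<? p)) i (descentParity (suc i) k) S)

  parity-below : ∀ k → ParityBelow k
  parity-above : ∀ k → ParityAbove k

  parity-below zero    U i p []      _  _ = refl
  parity-below zero    U i p (_ ∷ _) _  _ = refl
  parity-below (suc k) U i p S #U p-below with least-available U #U
  ... | c , c<n , c-available , c-least = step-below i p S (p-below c c<n c-available)
    where open Step k (parity-below k) (parity-above k) U #U c c<n c-available c-least

  parity-above zero    U i p S j #U j<n avail _ =
    ⊥-elim (0≢1+n (trans (sym #U) (#available-∷ U (ℤ.+ suc j) refl j<n avail)))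
  parity-above (suc k) U i p S j #U j<n avail j<|p| with least-available U #U
  ... | c , c<n , c-available , c-least = step-above i p S (≤-<-trans (s≤s (c≤ j avail)) j<|p|)
    where open Step k (parity-below k) (parity-above k) U #U c c<n c-available c-least

  rB-odd : ∀ α → T (isPseudoComposition n α) → parity (rB n α) ≡ 1ℙ
  rB-odd α isPC = begin
    parity (rB n α)
      ≡⟨ cong parity (rB-#matching α) ⟩
    parity (#matching [] 0 (ℤ.+ 0) (descentSetPC α) n)
      ≡⟨ parity-below n [] 0 (ℤ.+ 0) (descentSetPC α) #available-[] (λ _ _ _ → z≤n) ⟩
    descentParity 0 n (descentSetPC α)
      ≡⟨ descentParity-pseudoComposition n α isPC ⟩
    1ℙ
      ∎
    where
    open ≡-Reasoning
    #available-[] : #available [] ≡ n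
    #available-[] = trans (count-true (upTo n)) (length-upTo n)

open SignedWords using (rB-odd)

corollary4p2 : (n : ℕ) → 1 Data.Nat.≤ n →
    (cB 2 0 n ≡ 0 × cB 2 1 n ≡ 2 ^ n)
corollary4p2 n _ =
  count-filter-constant false (λ α isPC → cong (_≡ᵇ 0) (rB-mod2 α isPC)) candidates ,
  trans (count-filter-constant true (λ α isPC → cong (_≡ᵇ 1) (rB-mod2 α isPC)) candidates)
        (length-pseudoCompositions n)
  where
  rB-mod2 : ∀ α → isPseudoComposition n α ≡ true → rB n α % 2 ≡ 1
  rB-mod2 α isPC = parity≡1ℙ⇒%2≡1 (rB n α) (rB-odd n α (Equivalence.from T-≡ isPC))
  candidates : List (List ℕ)
  candidates = allListsUpTo (suc n) (upTo (suc n))
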